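{- Let $X$ be an infinite set and $f:X\to X$ a surjective function such that there is at most one $x\in X$ with $\#f^{ -1}(x)=1$. Then for every $a\in X$, either $\#T_\infty(f,a)=1$ or $T_\infty(f,a)$ is infinite.
   Context: $T_\infty(f,a)=\{a\}\cup f^{ -1}(a)\cup f^{ -2}(a)\cup\cdots$, where $f^{ -n}(a)=\{x\in X:f^n(x)=a\}$ and $f^n$ is the $n$th iterate. -}

module Defs where

open import Data.Nat using (ℕ; zero; suc)
open import Data.Nat.GeneralisedArithmetic using (iterate)
open import Data.Fin using (Fin)
open import Data.Product using (Σ; ∃; ∃-syntax; _×_)
open import Data.Unit using (⊤)
open import Data.Sum using (_⊎_)
open import Function.Definitions using (Injective)
open import Relation.Nullary using (¬_)
open import Relation.Binary.PropositionalEquality using (_≡_)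

-- A subset of X is a predicate on X.
-- "P has exactly n elements": an injective enumeration Fin n → X whose
-- image is exactly P.  (Stated via an enumeration rather than the subtype
-- Σ X P, since membership proofs need not be unique.)
HasCard : {X : Set} → (X → Set) → ℕ → Set
HasCard {X} P n =
  Σ (Fin n → X) λ g →
    Injective _≡_ _≡_ g × (∀ i → P (g i)) × (∀ x → P x → ∃[ i ] g i ≡ x)

FiniteSubset : {X : Set} → (X → Set) → Set
FiniteSubset P = ∃[ n ] HasCard P n

InfiniteSubset : {X : Set} → (X → Set) → Set
InfiniteSubset P = ¬ FiniteSubset P

InfiniteSet : Set → Set
InfiniteSet X = InfiniteSubset {X} (λ _ → ⊤)

_^[_]_ : {X : Set} → (X → X) → ℕ → X → X
f ^[ n ] x = iterate f x n

Preimage : {X : Set} → (X → X) → X → X → Set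
Preimage f a x = f x ≡ a

-- T_∞(f,a) = {a} ∪ f^{-1}(a) ∪ f^{-2}(a) ∪ ...  = { x : ∃ n, f^n(x) = a }
-- (n = 0 gives {a}).
Tinf : {X : Set} → (X → X) → X → X → Set
Tinf f a x = ∃[ n ] f ^[ n ] x ≡ a

{-# OPTIONS --safe #-}
module Submission where

-- If T∞(f,a) is finite, pick for each of its elements a preimage under f; these preimages
-- lie in T∞(f,a) again, so choosing them is an injective self-map of a finite set, hence onto.
-- Consequently every preimage of an element of T∞(f,a) is the chosen one: each element of
-- T∞(f,a) has exactly one preimage. Since at most one point of X has that property,
-- T∞(f,a) = {a}. This gives "finite ⇒ singleton", from which the dichotomy follows up to
-- double negation.

open import Defs
open import Data.Empty using (⊥-elim)
open import Data.Fin using (Fin; zero; suc; punchOut)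
open import Data.Fin.Properties using (any?; _≟_; punchOut-injective; <⇒notInjective)
open import Data.Nat using (ℕ; zero; suc)
open import Data.Nat.Properties using (n<1+n)
open import Data.Product using (∃; _,_; proj₁; proj₂)
open import Data.Sum using (_⊎_; inj₁; inj₂)
open import Function.Consequences.Propositional using (surjective⇒strictlySurjective)
open import Function.Definitions using (Injective; Surjective; StrictlySurjective)
open import Relation.Nullary using (¬_; yes; no)
open import Relation.Nullary.Decidable using (Dec; ¬¬-excluded-middle)
open import Relation.Nullary.Negation using (¬¬-map; contradiction)
open import Relation.Binary.PropositionalEquality using (_≡_; _≢_; refl; sym; trans; cong; subst)

injective⇒strictlySurjective : ∀ {n} {h : Fin n → Fin n} →
                               Injective _≡_ _≡_ h → StrictlySurjective _≡_ h
injective⇒strictlySurjective {suc m} {h} h-inj i with any? (λ k → h k ≟ i)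
... | yes hit = hit
... | no  miss = ⊥-elim (<⇒notInjective (n<1+n m) squeezed-injective)
  where
  i≢h : ∀ k → i ≢ h k
  i≢h k i≡hk = miss (k , sym i≡hk)

  squeezed : Fin (suc m) → Fin m
  squeezed k = punchOut (i≢h k)

  squeezed-injective : Injective _≡_ _≡_ squeezed
  squeezed-injective e = h-inj (punchOut-injective (i≢h _) (i≢h _) e)

module _ {X : Set} {f : X → X} (f-surj : Surjective _≡_ _≡_ f)
         {P : X → Set} (P-preimage-closed : ∀ {x} → P (f x) → P x)
         {n : ℕ} {g : Fin n → X} (g-inj : Injective _≡_ _≡_ g)
         (g∈P : ∀ i → P (g i)) (g-onto : ∀ x → P x → ∃ λ i → g i ≡ x) where

  private
    f⁻¹ : X → X
    f⁻¹ y = proj₁ (surjective⇒strictlySurjective f-surj y)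

    f∘f⁻¹ : ∀ y → f (f⁻¹ y) ≡ y
    f∘f⁻¹ y = proj₂ (surjective⇒strictlySurjective f-surj y)

    index : ∀ x → P x → Fin n
    index x x∈P = proj₁ (g-onto x x∈P)

    g∘index : ∀ x (x∈P : P x) → g (index x x∈P) ≡ x
    g∘index x x∈P = proj₂ (g-onto x x∈P)

    preimage∈P : ∀ {x} i → f x ≡ g i → P x
    preimage∈P i fx≡gi = P-preimage-closed (subst P (sym fx≡gi) (g∈P i))

    chosenPreimage : Fin n → Fin n
    chosenPreimage i = index (f⁻¹ (g i)) (preimage∈P i (f∘f⁻¹ (g i)))

    f∘g∘chosenPreimage : ∀ i → f (g (chosenPreimage i)) ≡ g i
    f∘g∘chosenPreimage i =
      trans (cong f (g∘index _ (preimage∈P i (f∘f⁻¹ (g i))))) (f∘f⁻¹ (g i))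

    chosenPreimage-injective : Injective _≡_ _≡_ chosenPreimage
    chosenPreimage-injective {i} {j} e = g-inj
      (trans (sym (f∘g∘chosenPreimage i))
        (trans (cong (λ k → f (g k)) e) (f∘g∘chosenPreimage j)))

    preimage-unique : ∀ {x} i → f x ≡ g i → g (chosenPreimage i) ≡ x
    preimage-unique {x} i fx≡gi
      with index x (preimage∈P i fx≡gi) | g∘index x (preimage∈P i fx≡gi)
    ... | j | refl with injective⇒strictlySurjective chosenPreimage-injective j
    ... | k , refl with g-inj (trans (sym (f∘g∘chosenPreimage k)) fx≡gi)
    ... | refl = refl

  finite-preimageClosed⇒uniquePreimage : ∀ i → HasCard (Preimage f (g i)) 1
  finite-preimageClosed⇒uniquePreimage i =
    (λ _ → g (chosenPreimage i)) , (λ { {zero} {zero} _ → refl }) ,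
    (λ _ → f∘g∘chosenPreimage i) , (λ x fx≡gi → zero , preimage-unique i fx≡gi)

Tinf-preimageClosed : ∀ {X : Set} {f : X → X} {a x} → Tinf f a (f x) → Tinf f a x
Tinf-preimageClosed (n , fⁿfx≡a) = suc n , fⁿfx≡a

module _ {X : Set} {f : X → X} (f-surj : Surjective _≡_ _≡_ f)
         (atMostOneUnique : ∀ x y → HasCard (Preimage f x) 1 → HasCard (Preimage f y) 1 → x ≡ y)
         (a : X) where

  finite-Tinf⇒singleton : ∀ {n} → HasCard (Tinf f a) n → HasCard (Tinf f a) 1
  finite-Tinf⇒singleton {zero} (_ , _ , _ , g-onto) with g-onto a (0 , refl)
  ... | () , _
  finite-Tinf⇒singleton {suc zero} card = card
  finite-Tinf⇒singleton {suc (suc n)} (g , g-inj , g∈T , g-onto) =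
    contradiction (g-inj (atMostOneUnique _ _ (uniquePreimage zero) (uniquePreimage (suc zero)))) λ ()
    where
    uniquePreimage : ∀ i → HasCard (Preimage f (g i)) 1
    uniquePreimage = finite-preimageClosed⇒uniquePreimage f-surj Tinf-preimageClosed g-inj g∈T g-onto

mainTheorem19 : (X : Set) → InfiniteSet X → (f : X → X) → Surjective _≡_ _≡_ f →
    (∀ x y → HasCard (Preimage f x) 1 → HasCard (Preimage f y) 1 → x ≡ y) →
    (a : X) → ¬ ¬ (HasCard (Tinf f a) 1 ⊎ InfiniteSubset (Tinf f a))
mainTheorem19 X _ f f-surj atMostOneUnique a = ¬¬-map dichotomy ¬¬-excluded-middle
  where
  dichotomy : Dec (FiniteSubset (Tinf f a)) → HasCard (Tinf f a) 1 ⊎ InfiniteSubset (Tinf f a)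
  dichotomy (yes (_ , card)) = inj₁ (finite-Tinf⇒singleton f-surj atMostOneUnique a card)
  dichotomy (no infinite)    = inj₂ infinite
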